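{- The calculus $\mathbf{L}^{\Lambda}\wedge\mathbf{0}\mathbf{1}$ is strongly sound with respect to the class of non-standard square R-models: for every set of sequents $\mathcal{H}$ and every sequent $\Pi\to B$, if $\Pi \to B$ is derivable from $\mathcal{H}$ in $\mathbf{L}^{\Lambda}\wedge\mathbf{0}\mathbf{1}$, then $\Pi\to B$ is true in every non-standard square R-model in which all sequents of $\mathcal{H}$ are true.
   Context: Formulae are built from a countable set of propositional variables and the constants $\mathbf{0}$ and $\mathbf{1}$ using the binary connectives $\cdot$, $\backslash$, $/$, $\wedge$. A sequent is $\Pi \to B$ with $B$ a formula and $\Pi$ a finite, possibly empty, sequence of formulae (empty sequence written $\Lambda$). The calculus $\mathbf{L}^{\Lambda}\wedge\mathbf{0}\mathbf{1}$ has the axioms $A \to A$, $\Gamma,\mathbf{0},\Delta \to C$ and $\Lambda \to \mathbf{1}$, and rules (capital Greek letters denote possibly empty sequences): (Cut) from $\Pi \to A$ and $\Gamma, A, \Delta \to C$ infer $\Gamma,\Pi,\Delta\to C$; ($\backslash L$) from $\Pi\to A$ and $\Gamma,B,\Delta\to C$ infer $\Gamma,\Pi,A\backslash B,\Delta\to C$; ($\backslash R$) from $A,\Pi\to B$ infer $\Pi\to A\backslash B$; ($/ L$) from $\Pi\to A$ and $\Gamma,B,\Delta\to C$ infer $\Gamma,B/A,\Pi,\Delta\to C$; ($/R$) from $\Pi,A\to B$ infer $\Pi\to B/A$; ($\cdot L$) from $\Gamma,A,B,\Delta\to C$ infer $\Gamma,A\cdot B,\Delta\to C$; ($\cdot R$)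 from $\Pi\to A$ and $\Delta\to B$ infer $\Pi,\Delta\to A\cdot B$; ($\wedge L$) from $\Gamma,A,\Delta\to C$ infer both $\Gamma,A\wedge B,\Delta\to C$ and $\Gamma,B\wedge A,\Delta\to C$; ($\wedge R$) from $\Pi\to A$ and $\Pi\to B$ infer $\Pi\to A\wedge B$; ($\mathbf{1} L$) from $\Gamma,\Delta\to C$ infer $\Gamma,\mathbf{1},\Delta\to C$. A sequent is derivable from a set of sequents $\mathcal H$ if it is derivable when the sequents of $\mathcal H$ are added as extra axioms. For binary relations $R,S$ on a non-empty set $W$: $R\circ S=\{(x,z) \mid \exists y\,((x,y)\in R, (y,z)\in S)\}$; $R\backslash S=\{(y,z)\in W\times W \mid \forall x\,((x,y)\in R\Rightarrow (x,z)\in S)\}$; $S/R=\{(x,y)\in W\times W \mid \forall z\,((y,z)\in R\Rightarrow(x,z)\in S)\}$; $\delta=\{(x,x)\mid x\in W\}$. A non-standard square R-model is a tuple $(W,\mathfrak{A},\mathbf{1}_{\mathfrak{A}},\mathbf{0}_{\mathfrak{A}},v)$ where $W$ is non-empty; $\mathfrak{A}$ is a family of binary relations on $W$ closed under $\circ,\backslash,/,\cap$; $\mathbf{1}_{\mathfrak{A}}\in\mathfrak{A}$ satisfies $\mathbf{1}_{\mathfrak{A}}\circ R=R\circ\mathbf{1}_{\mathfrak{A}}=R$ for all $R\in\mathfrak{A}$; $\mathbf{0}_{\mathfrak{A}}\in\mathfrak{A}$ satisfies $\mathbf{0}_{\mathfrak{A}}\subseteq R$ for all $R\in\mathfrak{A}$;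 and $v$ maps every formula to a member of $\mathfrak{A}$ with $v(A\cdot B)=v(A)\circ v(B)$, $v(A\backslash B)=v(A)\backslash v(B)$, $v(B/A)=v(B)/v(A)$, $v(A\wedge B)=v(A)\cap v(B)$, $v(\mathbf{1})=\mathbf{1}_{\mathfrak{A}}$, $v(\mathbf{0})=\mathbf{0}_{\mathfrak{A}}$. A sequent $A_1,\ldots,A_n\to B$ ($n\ge1$) is true in the model if $v(A_1)\circ\cdots\circ v(A_n)\subseteq v(B)$, and $\Lambda\to B$ is true if $\delta\subseteq v(B)$. -}

module Defs where

open import Data.Nat using (ℕ)
open import Data.List using (List; []; _∷_; _++_)
open import Data.Product using (Σ; _×_; _,_)
open import Function.Bundles using (_⇔_)
open import Relation.Binary.PropositionalEquality using (_≡_)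

infixr 30 _·_
infixr 25 _∖_
infixl 25 _╱_
infixr 20 _∧_

data Fm : Set where
  var  : ℕ → Fm
  𝟎 𝟏  : Fm
  _·_  : Fm → Fm → Fm
  _∖_  : Fm → Fm → Fm
  _╱_  : Fm → Fm → Fm
  _∧_  : Fm → Fm → Fm

infix 4 _⇒_
record Sequent : Set where
  constructor _⇒_
  field
    ant : List Fm
    suc : Fm

data Derivable (H : Sequent → Set) : Sequent → Set where
  hyp  : ∀ {s} → H s → Derivable H s
  ax   : ∀ {A} → Derivable H (A ∷ [] ⇒ A)
  ax0  : ∀ {Γ Δ C} → Derivable H (Γ ++ 𝟎 ∷ Δ ⇒ C)
  ax1  : Derivable H ([] ⇒ 𝟏)
  cut  : ∀ {Π A Γ Δ C} → Derivable H (Π ⇒ A) → Derivable H (Γ ++ A ∷ Δ ⇒ C)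
       → Derivable H (Γ ++ Π ++ Δ ⇒ C)
  ∖L   : ∀ {Π A Γ B Δ C} → Derivable H (Π ⇒ A) → Derivable H (Γ ++ B ∷ Δ ⇒ C)
       → Derivable H (Γ ++ Π ++ (A ∖ B) ∷ Δ ⇒ C)
  ∖R   : ∀ {A Π B} → Derivable H (A ∷ Π ⇒ B) → Derivable H (Π ⇒ A ∖ B)
  ╱L   : ∀ {Π A Γ B Δ C} → Derivable H (Π ⇒ A) → Derivable H (Γ ++ B ∷ Δ ⇒ C)
       → Derivable H (Γ ++ (B ╱ A) ∷ Π ++ Δ ⇒ C)
  ╱R   : ∀ {Π A B} → Derivable H (Π ++ A ∷ [] ⇒ B) → Derivable H (Π ⇒ B ╱ A)
  ·L   : ∀ {Γ A B Δ C} → Derivable H (Γ ++ A ∷ B ∷ Δ ⇒ C)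
       → Derivable H (Γ ++ (A · B) ∷ Δ ⇒ C)
  ·R   : ∀ {Π A Δ B} → Derivable H (Π ⇒ A) → Derivable H (Δ ⇒ B)
       → Derivable H (Π ++ Δ ⇒ A · B)
  ∧L₁  : ∀ {Γ A B Δ C} → Derivable H (Γ ++ A ∷ Δ ⇒ C)
       → Derivable H (Γ ++ (A ∧ B) ∷ Δ ⇒ C)
  ∧L₂  : ∀ {Γ A B Δ C} → Derivable H (Γ ++ A ∷ Δ ⇒ C)
       → Derivable H (Γ ++ (B ∧ A) ∷ Δ ⇒ C)
  ∧R   : ∀ {Π A B} → Derivable H (Π ⇒ A) → Derivable H (Π ⇒ B)
       → Derivable H (Π ⇒ A ∧ B)
  𝟏L   : ∀ {Γ Δ C} → Derivable H (Γ ++ Δ ⇒ C) → Derivable H (Γ ++ 𝟏 ∷ Δ ⇒ C)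

BRel : Set → Set₁
BRel W = W → W → Set

module _ {W : Set} where

  _⊆ʳ_ : BRel W → BRel W → Set
  R ⊆ʳ S = ∀ x y → R x y → S x y

  _≐_ : BRel W → BRel W → Set
  R ≐ S = ∀ x y → R x y ⇔ S x y

  _∘ʳ_ : BRel W → BRel W → BRel W
  (R ∘ʳ S) x z = Σ W λ y → R x y × S y z

  _∖ʳ_ : BRel W → BRel W → BRel W
  (R ∖ʳ S) y z = ∀ x → R x y → S x z

  _╱ʳ_ : BRel W → BRel W → BRel W
  (S ╱ʳ R) x y = ∀ z → R y z → S x z

  _∩ʳ_ : BRel W → BRel W → BRel W
  (R ∩ʳ S) x y = R x y × S x y

  δ : BRel W
  δ x y = x ≡ y

record NSModel : Set₁ where
  field
    W    : Set
    w₀   : W                        -- W is non-empty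
    𝔄    : BRel W → Set
    ∘-cl : ∀ {R S} → 𝔄 R → 𝔄 S → 𝔄 (R ∘ʳ S)
    ∖-cl : ∀ {R S} → 𝔄 R → 𝔄 S → 𝔄 (R ∖ʳ S)
    ╱-cl : ∀ {R S} → 𝔄 R → 𝔄 S → 𝔄 (S ╱ʳ R)
    ∩-cl : ∀ {R S} → 𝔄 R → 𝔄 S → 𝔄 (R ∩ʳ S)
    𝟏𝔄   : BRel W
    𝟏∈   : 𝔄 𝟏𝔄
    𝟏-unitˡ : ∀ {R} → 𝔄 R → (𝟏𝔄 ∘ʳ R) ≐ R
    𝟏-unitʳ : ∀ {R} → 𝔄 R → (R ∘ʳ 𝟏𝔄) ≐ R
    𝟎𝔄   : BRel W
    𝟎∈   : 𝔄 𝟎𝔄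
    𝟎-least : ∀ {R} → 𝔄 R → 𝟎𝔄 ⊆ʳ R
    v    : Fm → BRel W
    v∈   : ∀ A → 𝔄 (v A)
    v-·  : ∀ A B → v (A · B) ≐ (v A ∘ʳ v B)
    v-∖  : ∀ A B → v (A ∖ B) ≐ (v A ∖ʳ v B)
    v-╱  : ∀ A B → v (B ╱ A) ≐ (v B ╱ʳ v A)
    v-∧  : ∀ A B → v (A ∧ B) ≐ (v A ∩ʳ v B)
    v-𝟏  : v 𝟏 ≐ 𝟏𝔄
    v-𝟎  : v 𝟎 ≐ 𝟎𝔄

module _ (M : NSModel) where
  open NSModel M

  -- v(A₁) ∘ ... ∘ v(Aₙ), n ≥ 1, given as head and tail
  compose : Fm → List Fm → BRel W
  compose A []      = v A
  compose A (B ∷ Π) = v A ∘ʳ compose B Π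

  TrueIn : Sequent → Set
  TrueIn ([] ⇒ B)    = δ ⊆ʳ v B
  TrueIn (A ∷ Π ⇒ B) = compose A Π ⊆ʳ v B

{-# OPTIONS --safe #-}
-- In a non-standard model 𝟎 need not be empty and 𝟏 need not be the diagonal,
-- so the 𝟎-axiom and 𝟏L cannot be verified pointwise. Instead, the context
-- around the distinguished formula is absorbed into the residual Γ ∖ (C ╱ Δ),
-- which belongs to 𝔄: the sequent Γ, Σ, Δ → C holds iff ⟦Σ⟧ ⊆ Γ ∖ (C ╱ Δ).
-- There 𝟎 is below every member of 𝔄, and 𝟏 is below every member of 𝔄
-- containing the diagonal.
module Submission where

open import Defs
open import Data.List using (List; []; _∷_; _++_)
open import Data.List.Properties using (++-assoc)
open import Data.Product using (_,_; proj₁; proj₂)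
open import Function.Bundles using (Equivalence)
open import Relation.Binary.PropositionalEquality using (refl; subst)

module _ {W : Set} where

  ⊆ʳ-trans : {R S T : BRel W} → R ⊆ʳ S → S ⊆ʳ T → R ⊆ʳ T
  ⊆ʳ-trans p q x y r = q x y (p x y r)

  ≐⇒⊆ : {R S : BRel W} → R ≐ S → R ⊆ʳ S
  ≐⇒⊆ p x y = Equivalence.to (p x y)

  ≐⇒⊇ : {R S : BRel W} → R ≐ S → S ⊆ʳ R
  ≐⇒⊇ p x y = Equivalence.from (p x y)

module Semantics (M : NSModel) where
  open NSModel M

  ⟦_⟧ : List Fm → BRel W
  ⟦ [] ⟧    = δ
  ⟦ A ∷ Γ ⟧ = v A ∘ʳ ⟦ Γ ⟧

  Holds : Sequent → Set
  Holds (Γ ⇒ B) = ⟦ Γ ⟧ ⊆ʳ v B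

  ⟦∷⟧⊆compose : ∀ A Π → ⟦ A ∷ Π ⟧ ⊆ʳ compose M A Π
  ⟦∷⟧⊆compose A []      x y (_ , a , refl) = a
  ⟦∷⟧⊆compose A (B ∷ Π) x y (u , a , p)    = u , a , ⟦∷⟧⊆compose B Π u y p

  compose⊆⟦∷⟧ : ∀ A Π → compose M A Π ⊆ʳ ⟦ A ∷ Π ⟧
  compose⊆⟦∷⟧ A []      x y a           = y , a , refl
  compose⊆⟦∷⟧ A (B ∷ Π) x y (u , a , p) = u , a , compose⊆⟦∷⟧ B Π u y p

  trueIn⇒holds : ∀ s → TrueIn M s → Holds s
  trueIn⇒holds ([] ⇒ B)    t = t
  trueIn⇒holds (A ∷ Π ⇒ B) t = ⊆ʳ-trans (⟦∷⟧⊆compose A Π) t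

  holds⇒trueIn : ∀ s → Holds s → TrueIn M s
  holds⇒trueIn ([] ⇒ B)    h = h
  holds⇒trueIn (A ∷ Π ⇒ B) h = ⊆ʳ-trans (compose⊆⟦∷⟧ A Π) h

  ⟦++⟧⊆∘ : ∀ Γ Δ → ⟦ Γ ++ Δ ⟧ ⊆ʳ (⟦ Γ ⟧ ∘ʳ ⟦ Δ ⟧)
  ⟦++⟧⊆∘ []      Δ x z p           = x , refl , p
  ⟦++⟧⊆∘ (A ∷ Γ) Δ x z (u , a , p) with ⟦++⟧⊆∘ Γ Δ u z p
  ... | y , g , d = y , (u , a , g) , d

  ∘⊆⟦++⟧ : ∀ Γ Δ → (⟦ Γ ⟧ ∘ʳ ⟦ Δ ⟧) ⊆ʳ ⟦ Γ ++ Δ ⟧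
  ∘⊆⟦++⟧ []      Δ x z (.x , refl , d)        = d
  ∘⊆⟦++⟧ (A ∷ Γ) Δ x z (y , (u , a , g) , d) = u , a , ∘⊆⟦++⟧ Γ Δ u z (y , g , d)

  ⟦[]⟧⊆ : ∀ A → ⟦ A ∷ [] ⟧ ⊆ʳ v A
  ⟦[]⟧⊆ A x y (_ , a , refl) = a

  ⊆⟦[]⟧ : ∀ A → v A ⊆ʳ ⟦ A ∷ [] ⟧
  ⊆⟦[]⟧ A x y a = y , a , refl

  ⟦[]⟧-mono : ∀ {A B} → v A ⊆ʳ v B → ⟦ A ∷ [] ⟧ ⊆ʳ ⟦ B ∷ [] ⟧
  ⟦[]⟧-mono A⊆B x y (u , a , d) = u , A⊆B x u a , d

  -- Γ ∖ᶜ C and C ╱ᶜ Δ are ⟦Γ⟧ ∖ʳ C and C ╱ʳ ⟦Δ⟧ built one formula at a time,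
  -- so that they stay inside 𝔄 even though ⟦Γ⟧ and ⟦Δ⟧ need not.
  _∖ᶜ_ : List Fm → BRel W → BRel W
  []      ∖ᶜ C = C
  (A ∷ Γ) ∖ᶜ C = Γ ∖ᶜ (v A ∖ʳ C)

  _╱ᶜ_ : BRel W → List Fm → BRel W
  C ╱ᶜ []      = C
  C ╱ᶜ (A ∷ Δ) = (C ╱ᶜ Δ) ╱ʳ v A

  ∖ᶜ-cl : ∀ Γ {C} → 𝔄 C → 𝔄 (Γ ∖ᶜ C)
  ∖ᶜ-cl []      c = c
  ∖ᶜ-cl (A ∷ Γ) c = ∖ᶜ-cl Γ (∖-cl (v∈ A) c)

  ╱ᶜ-cl : ∀ Δ {C} → 𝔄 C → 𝔄 (C ╱ᶜ Δ)
  ╱ᶜ-cl []      c = c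
  ╱ᶜ-cl (A ∷ Δ) c = ╱-cl (v∈ A) (╱ᶜ-cl Δ c)

  ∖ᶜ⊆∖ʳ : ∀ Γ C → (Γ ∖ᶜ C) ⊆ʳ (⟦ Γ ⟧ ∖ʳ C)
  ∖ᶜ⊆∖ʳ []      C x y r .x refl        = r
  ∖ᶜ⊆∖ʳ (A ∷ Γ) C x y r w (u , a , g) = ∖ᶜ⊆∖ʳ Γ (v A ∖ʳ C) x y r u g w a

  ∖ʳ⊆∖ᶜ : ∀ Γ C → (⟦ Γ ⟧ ∖ʳ C) ⊆ʳ (Γ ∖ᶜ C)
  ∖ʳ⊆∖ᶜ []      C x y r = r x refl
  ∖ʳ⊆∖ᶜ (A ∷ Γ) C x y r = ∖ʳ⊆∖ᶜ Γ (v A ∖ʳ C) x y (λ u g w a → r w (u , a , g))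

  ╱ᶜ⊆╱ʳ : ∀ Δ C → (C ╱ᶜ Δ) ⊆ʳ (C ╱ʳ ⟦ Δ ⟧)
  ╱ᶜ⊆╱ʳ []      C x y r .y refl        = r
  ╱ᶜ⊆╱ʳ (A ∷ Δ) C x y r z (u , a , d) = ╱ᶜ⊆╱ʳ Δ C x u (r u a) z d

  ╱ʳ⊆╱ᶜ : ∀ Δ C → (C ╱ʳ ⟦ Δ ⟧) ⊆ʳ (C ╱ᶜ Δ)
  ╱ʳ⊆╱ᶜ []      C x y r     = r y refl
  ╱ʳ⊆╱ᶜ (A ∷ Δ) C x y r u a = ╱ʳ⊆╱ᶜ Δ C x u (λ z d → r z (u , a , d))

  frame : List Fm → List Fm → Fm → BRel W
  frame Γ Δ C = Γ ∖ᶜ (v C ╱ᶜ Δ)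

  frame-cl : ∀ Γ Δ C → 𝔄 (frame Γ Δ C)
  frame-cl Γ Δ C = ∖ᶜ-cl Γ (╱ᶜ-cl Δ (v∈ C))

  holds⇒⊆frame : ∀ Γ Σ Δ C → Holds (Γ ++ Σ ++ Δ ⇒ C) → ⟦ Σ ⟧ ⊆ʳ frame Γ Δ C
  holds⇒⊆frame Γ Σ Δ C h a b s =
    ∖ʳ⊆∖ᶜ Γ _ a b λ x g → ╱ʳ⊆╱ᶜ Δ (v C) x b λ z d →
      h x z (∘⊆⟦++⟧ Γ (Σ ++ Δ) x z (a , g , ∘⊆⟦++⟧ Σ Δ a z (b , s , d)))

  ⊆frame⇒holds : ∀ Γ Σ Δ C → ⟦ Σ ⟧ ⊆ʳ frame Γ Δ C → Holds (Γ ++ Σ ++ Δ ⇒ C)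
  ⊆frame⇒holds Γ Σ Δ C f x z p with ⟦++⟧⊆∘ Γ (Σ ++ Δ) x z p
  ... | a , g , q with ⟦++⟧⊆∘ Σ Δ a z q
  ... | b , s , d = ╱ᶜ⊆╱ʳ Δ (v C) x b (∖ᶜ⊆∖ʳ Γ _ a b (f a b s) x g) z d

  holds-antitone : ∀ Γ {Π Σ} Δ C → ⟦ Π ⟧ ⊆ʳ ⟦ Σ ⟧
                 → Holds (Γ ++ Σ ++ Δ ⇒ C) → Holds (Γ ++ Π ++ Δ ⇒ C)
  holds-antitone Γ {Π} {Σ} Δ C Π⊆Σ h =
    ⊆frame⇒holds Γ Π Δ C (⊆ʳ-trans Π⊆Σ (holds⇒⊆frame Γ Σ Δ C h))

  ⟦𝟎⟧⊆ : ∀ {R} → 𝔄 R → ⟦ 𝟎 ∷ [] ⟧ ⊆ʳ R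
  ⟦𝟎⟧⊆ r = ⊆ʳ-trans (⟦[]⟧⊆ 𝟎) (⊆ʳ-trans (≐⇒⊆ v-𝟎) (𝟎-least r))

  -- 𝟏 ∖ʳ 𝟏 is reflexive, so the unit law gives 𝟏 x y and (𝟏 ∖ʳ 𝟏) y x for some y,
  -- and the latter turns 𝟏 x y into 𝟏 x x.
  δ⊆𝟏 : δ ⊆ʳ 𝟏𝔄
  δ⊆𝟏 x .x refl with ≐⇒⊇ (𝟏-unitˡ (∖-cl 𝟏∈ 𝟏∈)) x x (λ _ o → o)
  ... | y , o , r = r x o

  𝟏⊆ : ∀ {R} → 𝔄 R → δ ⊆ʳ R → 𝟏𝔄 ⊆ʳ R
  𝟏⊆ r d x y o = ≐⇒⊆ (𝟏-unitˡ r) x y (y , o , d y y refl)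

  ⟦𝟏⟧⊆ : ∀ {R} → 𝔄 R → δ ⊆ʳ R → ⟦ 𝟏 ∷ [] ⟧ ⊆ʳ R
  ⟦𝟏⟧⊆ r d = ⊆ʳ-trans (⟦[]⟧⊆ 𝟏) (⊆ʳ-trans (≐⇒⊆ v-𝟏) (𝟏⊆ r d))

  module _ (H : Sequent → Set) (H-true : ∀ h → H h → TrueIn M h) where

    sound : ∀ {s} → Derivable H s → Holds s
    sound (hyp {s} h) = trueIn⇒holds s (H-true s h)
    sound ax = ⟦[]⟧⊆ _
    sound (ax0 {Γ} {Δ} {C}) = ⊆frame⇒holds Γ (𝟎 ∷ []) Δ C (⟦𝟎⟧⊆ (frame-cl Γ Δ C))
    sound ax1 = ⊆ʳ-trans δ⊆𝟏 (≐⇒⊇ v-𝟏)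
    sound (cut {A = A} {Γ} {Δ} {C} d e) =
      holds-antitone Γ Δ C (⊆ʳ-trans (sound d) (⊆⟦[]⟧ A)) (sound e)
    sound (∖L {Π} {A} {Γ} {B} {Δ} {C} d e) =
      subst (λ Θ → Holds (Γ ++ Θ ⇒ C)) (++-assoc Π (A ∖ B ∷ []) Δ)
        (holds-antitone Γ Δ C ⟦Π,A∖B⟧⊆⟦B⟧ (sound e))
      where
        ⟦Π,A∖B⟧⊆⟦B⟧ : ⟦ Π ++ A ∖ B ∷ [] ⟧ ⊆ʳ ⟦ B ∷ [] ⟧
        ⟦Π,A∖B⟧⊆⟦B⟧ x z p with ⟦++⟧⊆∘ Π (A ∖ B ∷ []) x z p
        ... | y , π , ab = z , ≐⇒⊆ (v-∖ A B) y z (⟦[]⟧⊆ _ y z ab) x (sound d x y π) , refl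
    sound (∖R {A} {B = B} d) y z π =
      ≐⇒⊇ (v-∖ A B) y z λ x a → sound d x z (y , a , π)
    sound (╱L {Π} {A} {Γ} {B} {Δ} {C} d e) =
      holds-antitone Γ Δ C ⟦B╱A,Π⟧⊆⟦B⟧ (sound e)
      where
        ⟦B╱A,Π⟧⊆⟦B⟧ : ⟦ B ╱ A ∷ Π ⟧ ⊆ʳ ⟦ B ∷ [] ⟧
        ⟦B╱A,Π⟧⊆⟦B⟧ x z (y , ba , π) = z , ≐⇒⊆ (v-╱ A B) x y ba z (sound d y z π) , refl
    sound (╱R {Π} {A} {B} d) x y π =
      ≐⇒⊇ (v-╱ A B) x y λ z a → sound d x z (∘⊆⟦++⟧ Π (A ∷ []) x z (y , π , ⊆⟦[]⟧ A y z a))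
    sound (·L {Γ} {A} {B} {Δ} {C} d) =
      holds-antitone Γ Δ C ⟦A·B⟧⊆⟦A,B⟧ (sound d)
      where
        ⟦A·B⟧⊆⟦A,B⟧ : ⟦ A · B ∷ [] ⟧ ⊆ʳ ⟦ A ∷ B ∷ [] ⟧
        ⟦A·B⟧⊆⟦A,B⟧ x z (.z , ab , refl) with ≐⇒⊆ (v-· A B) x z ab
        ... | y , a , b = y , a , z , b , refl
    sound (·R {Π} {A} {Δ} {B} d e) x z p with ⟦++⟧⊆∘ Π Δ x z p
    ... | y , π , q = ≐⇒⊇ (v-· A B) x z (y , sound d x y π , sound e y z q)
    sound (∧L₁ {Γ} {A} {B} {Δ} {C} d) =
      holds-antitone Γ Δ C (⟦[]⟧-mono (⊆ʳ-trans (≐⇒⊆ (v-∧ A B)) λ _ _ → proj₁)) (sound d)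
    sound (∧L₂ {Γ} {A} {B} {Δ} {C} d) =
      holds-antitone Γ Δ C (⟦[]⟧-mono (⊆ʳ-trans (≐⇒⊆ (v-∧ B A)) λ _ _ → proj₂)) (sound d)
    sound (∧R {A = A} {B} d e) x y π = ≐⇒⊇ (v-∧ A B) x y (sound d x y π , sound e x y π)
    sound (𝟏L {Γ} {Δ} {C} d) =
      ⊆frame⇒holds Γ (𝟏 ∷ []) Δ C
        (⟦𝟏⟧⊆ (frame-cl Γ Δ C) (holds⇒⊆frame Γ [] Δ C (sound d)))

proposition2p6 : (H : Sequent → Set) (s : Sequent) → Derivable H s →
                 (M : NSModel) → (∀ h → H h → TrueIn M h) → TrueIn M s
proposition2p6 H s d M H-true = holds⇒trueIn s (sound H H-true d)
  where open Semantics M
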